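{- Every finite, simple, connected graph $G$ of order $n\ge 3$ satisfies $$W_3(G)\ge \frac{n-2}{2}\,W(G).$$ Equality holds if and only if $G$ contains no three vertices $u,v,w$ such that both $2\max\{d(u,v),d(u,w),d(v,w)\}<d(u,v)+d(u,w)+d(v,w)$ and every choice of three shortest paths, one between each of the pairs $(u,v)$, $(v,w)$, $(w,u)$, consists of pairwise edge-disjoint paths.
   Context: $d(u,v)$ is the graph distance and $W(G)=\sum_{\{u,v\}\in\binom{V}{2}}d(u,v)$ is the Wiener index. The Steiner distance $d_3(u,v,w)$ is the number of edges of a smallest connected subgraph (subtree) of $G$ containing $u,v,w$, and $W_3(G)=\sum_{\{u,v,w\}\in\binom{V}{3}}d_3(u,v,w)$. -}

module Defs where

open import Data.Bool using (Bool; true; false; if_then_else_)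
open import Data.Nat using (ℕ; zero; suc; _+_; _*_; _≤_; _<_; _<ᵇ_; _⊔_)
open import Data.Fin using (Fin; toℕ)
open import Data.List using (List; []; _∷_)
open import Data.List.Relation.Unary.Any using (Any)
open import Data.List.Relation.Unary.Unique.Propositional using (Unique)
open import Data.Product using (Σ; _×_; _,_; ∃; proj₁)
open import Data.Empty using (⊥)
import Data.Fin as F
open import Data.Sum using (_⊎_)
open import Relation.Binary.PropositionalEquality using (_≡_)
open import Relation.Nullary using (¬_)

record Graph (n : ℕ) : Set where
  field
    adj    : Fin n → Fin n → Bool
    sym    : ∀ u v → adj u v ≡ adj v u
    irrefl : ∀ u → adj u u ≡ false
open Graph public

data Walk {n : ℕ} (E : Fin n → Fin n → Bool) : Fin n → Fin n → Set where
  []  : ∀ {u} → Walk E u u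
  _∷_ : ∀ {u v w} → E u v ≡ true → Walk E v w → Walk E u w

len : ∀ {n} {E : Fin n → Fin n → Bool} {u v} → Walk E u v → ℕ
len []      = 0
len (_ ∷ p) = suc (len p)

verts : ∀ {n} {E : Fin n → Fin n → Bool} {u v} → Walk E u v → List (Fin n)
verts {u = u} []      = u ∷ []
verts {u = u} (_ ∷ p) = u ∷ verts p

UsesEdge : ∀ {n} {E : Fin n → Fin n → Bool} {u v} → Walk E u v → Fin n → Fin n → Set
UsesEdge []                 x y = ⊥
UsesEdge {u = u} (_∷_ {v = v} _ p) x y =
  ((u ≡ x × v ≡ y) ⊎ (u ≡ y × v ≡ x)) ⊎ UsesEdge p x y

EdgeDisjoint : ∀ {n} {E : Fin n → Fin n → Bool} {a b c d} → Walk E a b → Walk E c d → Set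
EdgeDisjoint p q = ∀ x y → UsesEdge p x y → ¬ UsesEdge q x y

IsPath : ∀ {n} {E : Fin n → Fin n → Bool} {u v} → Walk E u v → Set
IsPath p = Unique (verts p)

Connected : ∀ {n} → Graph n → Set
Connected G = ∀ u v → Walk (adj G) u v

IsDistance : ∀ {n} → Graph n → (Fin n → Fin n → ℕ) → Set
IsDistance G d = ∀ u v →
  (Σ (Walk (adj G) u v) λ p → len p ≡ d u v) × (∀ (p : Walk (adj G) u v) → d u v ≤ len p)

ShortestPath : ∀ {n} (G : Graph n) (d : Fin n → Fin n → ℕ) → Fin n → Fin n → Set
ShortestPath G d u v = Σ (Walk (adj G) u v) λ p → IsPath p × len p ≡ d u v

sumFin : (n : ℕ) → (Fin n → ℕ) → ℕ
sumFin zero    f = 0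
sumFin (suc n) f = f F.zero + sumFin n (λ i → f (F.suc i))

sumPairs : (n : ℕ) → (Fin n → Fin n → ℕ) → ℕ
sumPairs n f = sumFin n λ u → sumFin n λ v →
  if toℕ u <ᵇ toℕ v then f u v else 0

sumTriples : (n : ℕ) → (Fin n → Fin n → Fin n → ℕ) → ℕ
sumTriples n f = sumFin n λ u → sumFin n λ v → sumFin n λ w →
  if toℕ u <ᵇ toℕ v then (if toℕ v <ᵇ toℕ w then f u v w else 0) else 0

record Subgraph {n : ℕ} (G : Graph n) : Set where
  field
    vs      : Fin n → Bool
    es      : Fin n → Fin n → Bool
    es-sym  : ∀ x y → es x y ≡ es y x
    es⊆E    : ∀ x y → es x y ≡ true → adj G x y ≡ true
    es-ends : ∀ x y → es x y ≡ true → vs x ≡ true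
open Subgraph public

edgeCount : ∀ {n} {G : Graph n} → Subgraph G → ℕ
edgeCount {n} H = sumPairs n λ x y → if es H x y then 1 else 0

SubConnected : ∀ {n} {G : Graph n} → Subgraph G → Set
SubConnected H = ∀ x y → vs H x ≡ true → vs H y ≡ true → Walk (es H) x y

Contains3 : ∀ {n} {G : Graph n} → Subgraph G → Fin n → Fin n → Fin n → Set
Contains3 H u v w = vs H u ≡ true × vs H v ≡ true × vs H w ≡ true

IsSteiner3 : ∀ {n} → Graph n → (Fin n → Fin n → Fin n → ℕ) → Set
IsSteiner3 G d3 = ∀ u v w →
  (Σ (Subgraph G) λ H → SubConnected H × Contains3 H u v w × edgeCount H ≡ d3 u v w)
  × (∀ (H : Subgraph G) → SubConnected H → Contains3 H u v w → d3 u v w ≤ edgeCount H)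

W : ∀ {n} → (Fin n → Fin n → ℕ) → ℕ
W {n} d = sumPairs n d

W3 : ∀ {n} → (Fin n → Fin n → Fin n → ℕ) → ℕ
W3 {n} d3 = sumTriples n d3

BadTriple : ∀ {n} (G : Graph n) (d : Fin n → Fin n → ℕ) → Fin n → Fin n → Fin n → Set
BadTriple G d u v w =
  ¬ u ≡ v × ¬ v ≡ w × ¬ u ≡ w
  × 2 * (d u v ⊔ d u w ⊔ d v w) < d u v + d u w + d v w
  × (∀ (P : ShortestPath G d u v) (Q : ShortestPath G d v w) (R : ShortestPath G d w u) →
       EdgeDisjoint (proj₁ P) (proj₁ Q) × EdgeDisjoint (proj₁ Q) (proj₁ R)
       × EdgeDisjoint (proj₁ P) (proj₁ R))

-- A connected subgraph containing u, v, w contains a path from u to v and a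
-- path from w to its first vertex x on that path, edge-disjoint from it; so
-- d₃(u,v,w) ≥ d(u,x) + d(v,x) + d(w,x) for some x. Conversely the geodesics
-- from any x to u, v, w span a connected subgraph, so d₃ is at most that sum
-- for every x. With the triangle inequality this gives
-- 2 d₃(u,v,w) ≥ d(u,v) + d(u,w) + d(v,w), with equality exactly when u, v, w
-- have a median; summing over triples counts each pair n − 2 times.
-- If every triple of smaller perimeter has a median, a triple without one is
-- bad: twice its longest side is below its perimeter (else the vertex
-- opposite that side is a median), and geodesics α–β, β–γ sharing an edge
-- share a vertex z ≠ β, so a median of the smaller triple α, z, γ is one of
-- α, β, γ. Conversely, a median x ≠ v of a bad triple would give geodesics
-- u–x–v and v–x–w sharing the first edge of a geodesic from x to v.

module Submission where

open import Defs hiding (sym)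
open import Data.Bool using (Bool; true; false; if_then_else_; _∨_; _∧_; T)
open import Data.Bool.Properties using (∧-comm; if-eta; T-≡)
open import Data.Empty using (⊥-elim)
open import Data.Fin using (Fin; zero; suc; toℕ; _≟_)
import Data.Fin.Properties as Fin
open import Data.List using (List; []; _∷_; map)
open import Data.Nat.ListAction using (sum)
open import Data.List.Membership.Propositional using (_∈_; _∉_; find; lose)
import Data.List.Membership.DecPropositional as DecMembership
open import Data.List.Relation.Binary.Subset.Propositional using (_⊆_)
open import Data.List.Relation.Unary.All using ([]; _∷_)
open import Data.List.Relation.Unary.All.Properties using (¬Any⇒All¬; All¬⇒¬Any)
open import Data.List.Relation.Unary.AllPairs using ([]; _∷_)
open import Data.List.Relation.Unary.Any as Any using (Any; here; there; any?)
open import Data.Nat using (ℕ; zero; suc; _+_; _*_; _∸_; _≤_; _<_; _<ᵇ_; _⊔_; z≤n; s≤s; _≤?_)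
open import Data.Nat.Induction using (<-rec)
open import Data.Nat.Properties hiding (_≟_)
open import Data.Nat.Tactic.RingSolver using (solve-∀)
import Algebra.Properties.CommutativeMonoid.Sum +-0-commutativeMonoid as ∑
open import Data.Product using (Σ; _×_; _,_; ∃; proj₁; proj₂; swap)
open import Data.Sum using (_⊎_; inj₁; inj₂)
open import Data.Unit using (⊤; tt)
open import Function using (_∘_)
open import Function.Bundles using (_⇔_; mk⇔; Equivalence)
open import Relation.Binary using (tri<; tri≈; tri>)
open import Relation.Binary.PropositionalEquality
open import Relation.Nullary using (¬_; Dec; yes; no; does; _⊎-dec_; _×-dec_)
open import Relation.Nullary.Decidable using (dec-true; dec-false; does-⇔)

𝟙 : Bool → ℕ
𝟙 b = if b then 1 else 0

𝟙-∨-≤ : ∀ a b → 𝟙 (a ∨ b) ≤ 𝟙 a + 𝟙 b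
𝟙-∨-≤ true  b = s≤s z≤n
𝟙-∨-≤ false b = ≤-refl

𝟙-∨-disjoint : ∀ a b → (a ≡ true → b ≡ false) → 𝟙 (a ∨ b) ≡ 𝟙 a + 𝟙 b
𝟙-∨-disjoint true  b a⇒¬b rewrite a⇒¬b refl = refl
𝟙-∨-disjoint false b a⇒¬b = refl

𝟙-mono : ∀ {a b} → (a ≡ true → b ≡ true) → 𝟙 a ≤ 𝟙 b
𝟙-mono {false}         a⇒b = z≤n
𝟙-mono {true}  {b}     a⇒b rewrite a⇒b refl = ≤-refl

does⇒ : ∀ {a} {A : Set a} (a? : Dec A) → does a? ≡ true → A
does⇒ (yes a) _ = a

𝟙<ᵇ+𝟙>ᵇ≤1 : ∀ a b → 𝟙 (a <ᵇ b) + 𝟙 (b <ᵇ a) ≤ 1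
𝟙<ᵇ+𝟙>ᵇ≤1 zero    zero    = z≤n
𝟙<ᵇ+𝟙>ᵇ≤1 zero    (suc b) = ≤-refl
𝟙<ᵇ+𝟙>ᵇ≤1 (suc a) zero    = ≤-refl
𝟙<ᵇ+𝟙>ᵇ≤1 (suc a) (suc b) = 𝟙<ᵇ+𝟙>ᵇ≤1 a b

𝟙<ᵇ+𝟙>ᵇ≡1 : ∀ {a b} → a ≢ b → 𝟙 (a <ᵇ b) + 𝟙 (b <ᵇ a) ≡ 1
𝟙<ᵇ+𝟙>ᵇ≡1 {zero}  {zero}  a≢b = ⊥-elim (a≢b refl)
𝟙<ᵇ+𝟙>ᵇ≡1 {zero}  {suc b} a≢b = refl
𝟙<ᵇ+𝟙>ᵇ≡1 {suc a} {zero}  a≢b = refl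
𝟙<ᵇ+𝟙>ᵇ≡1 {suc a} {suc b} a≢b = 𝟙<ᵇ+𝟙>ᵇ≡1 (a≢b ∘ cong suc)

-- Sums over Fin n

sumFin≡sum : ∀ n (f : Fin n → ℕ) → sumFin n f ≡ ∑.sum f
sumFin≡sum zero    f = refl
sumFin≡sum (suc n) f = cong (f zero +_) (sumFin≡sum n (f ∘ suc))

sumFin-cong : ∀ n {f g : Fin n → ℕ} → (∀ i → f i ≡ g i) → sumFin n f ≡ sumFin n g
sumFin-cong zero    f≗g = refl
sumFin-cong (suc n) f≗g = cong₂ _+_ (f≗g zero) (sumFin-cong n (f≗g ∘ suc))

sumFin-mono-≤ : ∀ n {f g : Fin n → ℕ} → (∀ i → f i ≤ g i) → sumFin n f ≤ sumFin n g
sumFin-mono-≤ zero    f≤g = z≤n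
sumFin-mono-≤ (suc n) f≤g = +-mono-≤ (f≤g zero) (sumFin-mono-≤ n (f≤g ∘ suc))

sumFin-const : ∀ n c → sumFin n (λ _ → c) ≡ n * c
sumFin-const zero    c = refl
sumFin-const (suc n) c = cong (c +_) (sumFin-const n c)

sumFin-zero : ∀ n → sumFin n (λ _ → 0) ≡ 0
sumFin-zero n = trans (sumFin-const n 0) (*-zeroʳ n)

sumFin-distrib-+ : ∀ n (f g : Fin n → ℕ) → sumFin n (λ i → f i + g i) ≡ sumFin n f + sumFin n g
sumFin-distrib-+ n f g = begin
  sumFin n (λ i → f i + g i) ≡⟨ sumFin≡sum n _ ⟩
  ∑.sum (λ i → f i + g i)    ≡⟨ ∑.∑-distrib-+ f g ⟩
  ∑.sum f + ∑.sum g          ≡⟨ sym (cong₂ _+_ (sumFin≡sum n f) (sumFin≡sum n g)) ⟩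
  sumFin n f + sumFin n g    ∎
  where open ≡-Reasoning

sumFin-distribˡ-* : ∀ n c (f : Fin n → ℕ) → sumFin n (λ i → c * f i) ≡ c * sumFin n f
sumFin-distribˡ-* zero    c f = sym (*-zeroʳ c)
sumFin-distribˡ-* (suc n) c f =
  trans (cong (c * f zero +_) (sumFin-distribˡ-* n c (f ∘ suc))) (sym (*-distribˡ-+ c _ _))

sumFin-distribʳ-* : ∀ n c (f : Fin n → ℕ) → sumFin n (λ i → f i * c) ≡ sumFin n f * c
sumFin-distribʳ-* n c f =
  trans (sumFin-cong n λ i → *-comm (f i) c) (trans (sumFin-distribˡ-* n c f) (*-comm c _))

sumFin-comm : ∀ m n (f : Fin m → Fin n → ℕ) →
  sumFin m (λ i → sumFin n (f i)) ≡ sumFin n (λ j → sumFin m (λ i → f i j))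
sumFin-comm m n f = begin
  sumFin m (λ i → sumFin n (f i))        ≡⟨ nested≡sum m n f ⟩
  ∑.sum (λ i → ∑.sum (f i))              ≡⟨ ∑.∑-comm f ⟩
  ∑.sum (λ j → ∑.sum (λ i → f i j))      ≡⟨ sym (nested≡sum n m (λ j i → f i j)) ⟩
  sumFin n (λ j → sumFin m (λ i → f i j)) ∎
  where
  open ≡-Reasoning
  nested≡sum : ∀ m n (f : Fin m → Fin n → ℕ) →
    sumFin m (λ i → sumFin n (f i)) ≡ ∑.sum (λ i → ∑.sum (f i))
  nested≡sum m n f = trans (sumFin≡sum m _) (∑.sum-cong-≗ (λ i → sumFin≡sum n (f i)))

sumFin-≤-equality : ∀ n {f g : Fin n → ℕ} → (∀ i → f i ≤ g i) →
  sumFin n f ≡ sumFin n g → ∀ i → f i ≡ g i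
sumFin-≤-equality (suc n) {f} {g} f≤g eq = pointwise
  where
  rest-≤ : sumFin n (f ∘ suc) ≤ sumFin n (g ∘ suc)
  rest-≤ = sumFin-mono-≤ n (f≤g ∘ suc)
  head-≡ : f zero ≡ g zero
  head-≡ = ≤-antisym (f≤g zero)
    (+-cancelʳ-≤ _ _ _ (≤-trans (+-monoʳ-≤ (g zero) rest-≤) (≤-reflexive (sym eq))))
  pointwise : ∀ i → f i ≡ g i
  pointwise zero    = head-≡
  pointwise (suc i) =
    sumFin-≤-equality n (f≤g ∘ suc) (+-cancelˡ-≡ (g zero) _ _ (trans (cong (_+ _) (sym head-≡)) eq)) i

sumFin-δ : ∀ n (a : Fin n) (f : Fin n → ℕ) → sumFin n (λ i → if does (a ≟ i) then f i else 0) ≡ f a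
sumFin-δ (suc n) zero    f = trans (cong (f zero +_) (sumFin-zero n)) (+-identityʳ (f zero))
sumFin-δ (suc n) (suc a) f = sumFin-δ n a (f ∘ suc)

-- Sums over pairs and triples of increasing indices

if-0-mono-≤ : ∀ b {x y} → x ≤ y → (if b then x else 0) ≤ (if b then y else 0)
if-0-mono-≤ true  x≤y = x≤y
if-0-mono-≤ false x≤y = z≤n

if-0-distrib-+ : ∀ b x y → (if b then x + y else 0) ≡ (if b then x else 0) + (if b then y else 0)
if-0-distrib-+ true  x y = refl
if-0-distrib-+ false x y = refl

if-0-distribˡ-* : ∀ b c x → (if b then c * x else 0) ≡ c * (if b then x else 0)
if-0-distribˡ-* true  c x = refl
if-0-distribˡ-* false c x = sym (*-zeroʳ c)

module _ {n : ℕ} where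

  sumFin² : (Fin n → Fin n → ℕ) → ℕ
  sumFin² f = sumFin n λ u → sumFin n (f u)

  sumFin²-cong : {f g : Fin n → Fin n → ℕ} → (∀ u v → f u v ≡ g u v) → sumFin² f ≡ sumFin² g
  sumFin²-cong f≗g = sumFin-cong n λ u → sumFin-cong n (f≗g u)

  sumFin²-mono-≤ : {f g : Fin n → Fin n → ℕ} → (∀ u v → f u v ≤ g u v) → sumFin² f ≤ sumFin² g
  sumFin²-mono-≤ f≤g = sumFin-mono-≤ n λ u → sumFin-mono-≤ n (f≤g u)

  sumFin²-distrib-+ : (f g : Fin n → Fin n → ℕ) →
    sumFin² (λ u v → f u v + g u v) ≡ sumFin² f + sumFin² g
  sumFin²-distrib-+ f g =
    trans (sumFin-cong n λ u → sumFin-distrib-+ n (f u) (g u)) (sumFin-distrib-+ n _ _)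

  sumFin²-distribˡ-* : ∀ c (f : Fin n → Fin n → ℕ) → sumFin² (λ u v → c * f u v) ≡ c * sumFin² f
  sumFin²-distribˡ-* c f =
    trans (sumFin-cong n λ u → sumFin-distribˡ-* n c (f u)) (sumFin-distribˡ-* n c _)

  sumPairs-cong : {f g : Fin n → Fin n → ℕ} → (∀ u v → f u v ≡ g u v) → sumPairs n f ≡ sumPairs n g
  sumPairs-cong f≗g = sumFin²-cong λ u v → cong (λ x → if toℕ u <ᵇ toℕ v then x else 0) (f≗g u v)

  sumPairs-zero : sumPairs n (λ _ _ → 0) ≡ 0
  sumPairs-zero = trans (sumFin²-cong λ u v → if-eta (toℕ u <ᵇ toℕ v))
                        (trans (sumFin-cong n λ _ → sumFin-zero n) (sumFin-zero n))

  sumPairs-mono-≤ : {f g : Fin n → Fin n → ℕ} → (∀ u v → f u v ≤ g u v) → sumPairs n f ≤ sumPairs n g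
  sumPairs-mono-≤ f≤g = sumFin²-mono-≤ λ u v → if-0-mono-≤ (toℕ u <ᵇ toℕ v) (f≤g u v)

  sumPairs-distrib-+ : (f g : Fin n → Fin n → ℕ) →
    sumPairs n (λ u v → f u v + g u v) ≡ sumPairs n f + sumPairs n g
  sumPairs-distrib-+ f g =
    trans (sumFin²-cong λ u v → if-0-distrib-+ (toℕ u <ᵇ toℕ v) (f u v) (g u v)) (sumFin²-distrib-+ _ _)

  sumPairs-δ : (a b : Fin n) →
    sumPairs n (λ u v → 𝟙 (does (a ≟ u) ∧ does (b ≟ v))) ≡ 𝟙 (toℕ a <ᵇ toℕ b)
  sumPairs-δ a b = begin
    sumPairs n (λ u v → 𝟙 (does (a ≟ u) ∧ does (b ≟ v)))
      ≡⟨ sumFin²-cong pointwise ⟩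
    sumFin² (λ u v → if does (b ≟ v) then (if does (a ≟ u) then 𝟙 (toℕ a <ᵇ toℕ b) else 0) else 0)
      ≡⟨ sumFin-cong n (λ u → sumFin-δ n b _) ⟩
    sumFin n (λ u → if does (a ≟ u) then 𝟙 (toℕ a <ᵇ toℕ b) else 0)
      ≡⟨ sumFin-δ n a _ ⟩
    𝟙 (toℕ a <ᵇ toℕ b) ∎
    where
    open ≡-Reasoning
    pointwise : ∀ u v → (if toℕ u <ᵇ toℕ v then 𝟙 (does (a ≟ u) ∧ does (b ≟ v)) else 0)
      ≡ (if does (b ≟ v) then (if does (a ≟ u) then 𝟙 (toℕ a <ᵇ toℕ b) else 0) else 0)
    pointwise u v with a ≟ u | b ≟ v
    ... | yes refl | yes refl = refl
    ... | yes refl | no _     = if-eta (toℕ a <ᵇ toℕ v)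
    ... | no _     | b≟v      = trans (if-eta (toℕ u <ᵇ toℕ v)) (sym (if-eta (does b≟v)))

count-above : ∀ n k → sumFin n (λ i → 𝟙 (k <ᵇ toℕ i)) ≡ n ∸ suc k
count-above zero    k       = refl
count-above (suc n) zero    = trans (sumFin-const n 1) (*-identityʳ n)
count-above (suc n) (suc k) = count-above n k

count-below : ∀ n k → k ≤ n → sumFin n (λ i → 𝟙 (toℕ i <ᵇ k)) ≡ k
count-below n       zero    _         = sumFin-zero n
count-below (suc n) (suc k) (s≤s k≤n) = cong suc (count-below n k k≤n)

count-between : ∀ n a b → b ≤ n →
  sumFin n (λ i → if a <ᵇ toℕ i then 𝟙 (toℕ i <ᵇ b) else 0) ≡ b ∸ suc a
count-between n       a       zero    _         =
  trans (sumFin-cong n λ i → if-eta (a <ᵇ toℕ i)) (sumFin-zero n)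
count-between (suc n) zero    (suc b) (s≤s b≤n) = count-below n b b≤n
count-between (suc n) (suc a) (suc b) (s≤s b≤n) = count-between n a b b≤n

if-if-0≡if-0*𝟙 : ∀ b c x → (if b then (if c then x else 0) else 0) ≡ (if b then x else 0) * 𝟙 c
if-if-0≡if-0*𝟙 true  true  x = sym (*-identityʳ x)
if-if-0≡if-0*𝟙 true  false x = sym (*-zeroʳ x)
if-if-0≡if-0*𝟙 false c     x = refl

if-if-0≡*if-𝟙 : ∀ b c x → (if b then (if c then x else 0) else 0) ≡ x * (if b then 𝟙 c else 0)
if-if-0≡*if-𝟙 true  true  x = sym (*-identityʳ x)
if-if-0≡*if-𝟙 true  false x = sym (*-zeroʳ x)
if-if-0≡*if-𝟙 false c     x = sym (*-zeroʳ x)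

if-if-0≡𝟙*if-0 : ∀ b c x → (if b then (if c then x else 0) else 0) ≡ 𝟙 b * (if c then x else 0)
if-if-0≡𝟙*if-0 true  c x = sym (+-identityʳ _)
if-if-0≡𝟙*if-0 false c x = refl

if-if-0-mono-≤ : ∀ b c {x y} → x ≤ y →
  (if b then (if c then x else 0) else 0) ≤ (if b then (if c then y else 0) else 0)
if-if-0-mono-≤ b c x≤y = if-0-mono-≤ b (if-0-mono-≤ c x≤y)

module _ {n : ℕ} where

  sumFin³ : (Fin n → Fin n → Fin n → ℕ) → ℕ
  sumFin³ f = sumFin n λ u → sumFin² (f u)

  sumFin³-cong : {f g : Fin n → Fin n → Fin n → ℕ} → (∀ u v w → f u v w ≡ g u v w) →
    sumFin³ f ≡ sumFin³ g
  sumFin³-cong f≗g = sumFin-cong n λ u → sumFin²-cong (f≗g u)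

  sumFin³-distrib-+ : (f g : Fin n → Fin n → Fin n → ℕ) →
    sumFin³ (λ u v w → f u v w + g u v w) ≡ sumFin³ f + sumFin³ g
  sumFin³-distrib-+ f g =
    trans (sumFin-cong n λ u → sumFin²-distrib-+ (f u) (g u)) (sumFin-distrib-+ n _ _)

  sumFin³-distribˡ-* : ∀ c (f : Fin n → Fin n → Fin n → ℕ) →
    sumFin³ (λ u v w → c * f u v w) ≡ c * sumFin³ f
  sumFin³-distribˡ-* c f =
    trans (sumFin-cong n λ u → sumFin²-distribˡ-* c (f u)) (sumFin-distribˡ-* n c _)

  ifIncreasing : (Fin n → Fin n → Fin n → ℕ) → Fin n → Fin n → Fin n → ℕ
  ifIncreasing f u v w = if toℕ u <ᵇ toℕ v then (if toℕ v <ᵇ toℕ w then f u v w else 0) else 0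

  sumTriples-cong : {f g : Fin n → Fin n → Fin n → ℕ} → (∀ u v w → f u v w ≡ g u v w) →
    sumTriples n f ≡ sumTriples n g
  sumTriples-cong f≗g = sumFin³-cong λ u v w →
    cong (λ x → if toℕ u <ᵇ toℕ v then (if toℕ v <ᵇ toℕ w then x else 0) else 0) (f≗g u v w)

  sumTriples-mono-≤ : {f g : Fin n → Fin n → Fin n → ℕ} → (∀ u v w → f u v w ≤ g u v w) →
    sumTriples n f ≤ sumTriples n g
  sumTriples-mono-≤ f≤g = sumFin-mono-≤ n λ u → sumFin²-mono-≤ λ v w →
    if-if-0-mono-≤ (toℕ u <ᵇ toℕ v) (toℕ v <ᵇ toℕ w) (f≤g u v w)

  sumTriples-distribˡ-* : ∀ c (f : Fin n → Fin n → Fin n → ℕ) →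
    sumTriples n (λ u v w → c * f u v w) ≡ c * sumTriples n f
  sumTriples-distribˡ-* c f = trans (sumFin³-cong λ u v w → pull-out (toℕ u <ᵇ toℕ v) (toℕ v <ᵇ toℕ w))
                                    (sumFin³-distribˡ-* c (ifIncreasing f))
    where
    pull-out : ∀ b b′ {x} →
      (if b then (if b′ then c * x else 0) else 0) ≡ c * (if b then (if b′ then x else 0) else 0)
    pull-out b b′ = trans (cong (λ y → if b then y else 0) (if-0-distribˡ-* b′ c _)) (if-0-distribˡ-* b c _)

  sumTriples-≤-equality : {f g : Fin n → Fin n → Fin n → ℕ} → (∀ u v w → f u v w ≤ g u v w) →
    sumTriples n f ≡ sumTriples n g → ∀ u v w → toℕ u < toℕ v → toℕ v < toℕ w → f u v w ≡ g u v w
  sumTriples-≤-equality {f} {g} f≤g eq u v w u<v v<w =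
    subst₂ (λ b c → (if b then (if c then f u v w else 0) else 0) ≡ (if b then (if c then g u v w else 0) else 0))
      (Equivalence.to T-≡ (<⇒<ᵇ u<v)) (Equivalence.to T-≡ (<⇒<ᵇ v<w))
      (sumFin-≤-equality n (inner u v) (sumFin-≤-equality n (middle u)
        (sumFin-≤-equality n outer eq u) v) w)
    where
    inner : ∀ u v w → ifIncreasing f u v w ≤ ifIncreasing g u v w
    inner u v w = if-if-0-mono-≤ (toℕ u <ᵇ toℕ v) (toℕ v <ᵇ toℕ w) (f≤g u v w)
    middle : ∀ u v → sumFin n (ifIncreasing f u v) ≤ sumFin n (ifIncreasing g u v)
    middle u v = sumFin-mono-≤ n (inner u v)
    outer : ∀ u → sumFin² (ifIncreasing f u) ≤ sumFin² (ifIncreasing g u)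
    outer u = sumFin-mono-≤ n (middle u)

weights-sum : ∀ a b n → a < b → b < n → (n ∸ suc b) + (b ∸ suc a) + a ≡ n ∸ 2
weights-sum a b n a<b b<n with m≤n⇒∃[o]m+o≡n a<b | m≤n⇒∃[o]m+o≡n b<n
... | k , refl | m , refl = begin
  (suc (suc a + k) + m ∸ suc (suc a + k)) + (suc a + k ∸ suc a) + a
    ≡⟨ cong₂ (λ p q → p + q + a) (m+n∸m≡n (suc (suc a + k)) m) (m+n∸m≡n (suc a) k) ⟩
  m + k + a ≡⟨ reorder m k a ⟩
  a + k + m ∎
  where
  open ≡-Reasoning
  reorder : ∀ m k a → m + k + a ≡ a + k + m
  reorder = solve-∀

module _ {n : ℕ} (d : Fin n → Fin n → ℕ) where

  private
    pair : Fin n → Fin n → ℕ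
    pair a b = if toℕ a <ᵇ toℕ b then d a b else 0

  open ≡-Reasoning

  sumTriples-firstPair : sumTriples n (λ u v w → d u v) ≡ sumFin² (λ a b → pair a b * (n ∸ suc (toℕ b)))
  sumTriples-firstPair = sumFin²-cong λ u v → begin
    sumFin n (λ w → ifIncreasing (λ u v w → d u v) u v w)
      ≡⟨ sumFin-cong n (λ w → if-if-0≡if-0*𝟙 (toℕ u <ᵇ toℕ v) (toℕ v <ᵇ toℕ w) (d u v)) ⟩
    sumFin n (λ w → pair u v * 𝟙 (toℕ v <ᵇ toℕ w))
      ≡⟨ sumFin-distribˡ-* n (pair u v) _ ⟩
    pair u v * sumFin n (λ w → 𝟙 (toℕ v <ᵇ toℕ w))
      ≡⟨ cong (pair u v *_) (count-above n (toℕ v)) ⟩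
    pair u v * (n ∸ suc (toℕ v)) ∎

  sumTriples-outerPair : sumTriples n (λ u v w → d u w) ≡ sumFin² (λ a b → d a b * (toℕ b ∸ suc (toℕ a)))
  sumTriples-outerPair = sumFin-cong n λ u → trans (sumFin-comm n n _) (sumFin-cong n λ w → begin
    sumFin n (λ v → ifIncreasing (λ u v w → d u w) u v w)
      ≡⟨ sumFin-cong n (λ v → if-if-0≡*if-𝟙 (toℕ u <ᵇ toℕ v) (toℕ v <ᵇ toℕ w) (d u w)) ⟩
    sumFin n (λ v → d u w * (if toℕ u <ᵇ toℕ v then 𝟙 (toℕ v <ᵇ toℕ w) else 0))
      ≡⟨ sumFin-distribˡ-* n (d u w) _ ⟩
    d u w * sumFin n (λ v → if toℕ u <ᵇ toℕ v then 𝟙 (toℕ v <ᵇ toℕ w) else 0)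
      ≡⟨ cong (d u w *_) (count-between n (toℕ u) (toℕ w) (<⇒≤ (Fin.toℕ<n w))) ⟩
    d u w * (toℕ w ∸ suc (toℕ u)) ∎)

  sumTriples-lastPair : sumTriples n (λ u v w → d v w) ≡ sumFin² (λ a b → toℕ a * pair a b)
  sumTriples-lastPair = begin
    sumTriples n (λ u v w → d v w)
      ≡⟨ sumFin²-cong (λ u v → trans
            (sumFin-cong n λ w → if-if-0≡𝟙*if-0 (toℕ u <ᵇ toℕ v) (toℕ v <ᵇ toℕ w) (d v w))
                                      (sumFin-distribˡ-* n (𝟙 (toℕ u <ᵇ toℕ v)) (pair v))) ⟩
    sumFin² (λ u v → 𝟙 (toℕ u <ᵇ toℕ v) * sumFin n (pair v))
      ≡⟨ sumFin-comm n n _ ⟩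
    sumFin n (λ v → sumFin n (λ u → 𝟙 (toℕ u <ᵇ toℕ v) * sumFin n (pair v)))
      ≡⟨ sumFin-cong n (λ v → trans (sumFin-distribʳ-* n _ _)
                                (cong (_* sumFin n (pair v)) (count-below n (toℕ v) (<⇒≤ (Fin.toℕ<n v))))) ⟩
    sumFin n (λ v → toℕ v * sumFin n (pair v))
      ≡⟨ sumFin-cong n (λ v → sym (sumFin-distribˡ-* n (toℕ v) (pair v))) ⟩
    sumFin² (λ a b → toℕ a * pair a b) ∎

  pairWeights : ∀ a b → pair a b * (n ∸ suc (toℕ b)) + d a b * (toℕ b ∸ suc (toℕ a)) + toℕ a * pair a b
    ≡ (n ∸ 2) * pair a b
  pairWeights a b with toℕ a <ᵇ toℕ b in a<ᵇb
  ... | true = begin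
    d a b * (n ∸ suc (toℕ b)) + d a b * (toℕ b ∸ suc (toℕ a)) + toℕ a * d a b
      ≡⟨ factor (d a b) (n ∸ suc (toℕ b)) (toℕ b ∸ suc (toℕ a)) (toℕ a) ⟩
    ((n ∸ suc (toℕ b)) + (toℕ b ∸ suc (toℕ a)) + toℕ a) * d a b
      ≡⟨ cong (_* d a b) (weights-sum (toℕ a) (toℕ b) n a<b (Fin.toℕ<n b)) ⟩
    (n ∸ 2) * d a b ∎
    where
    factor : ∀ x p q r → x * p + x * q + r * x ≡ (p + q + r) * x
    factor = solve-∀
    a<b : toℕ a < toℕ b
    a<b = <ᵇ⇒< _ _ (subst T (sym a<ᵇb) tt)
  ... | false = begin
    d a b * (toℕ b ∸ suc (toℕ a)) + toℕ a * 0
      ≡⟨ cong₂ (λ p q → d a b * p + q) (m≤n⇒m∸n≡0 (≤-trans b≤a (n≤1+n _))) (*-zeroʳ (toℕ a)) ⟩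
    d a b * 0 + 0 ≡⟨ cong (_+ 0) (*-zeroʳ (d a b)) ⟩
    0 ≡⟨ sym (*-zeroʳ (n ∸ 2)) ⟩
    (n ∸ 2) * 0 ∎
    where
    b≤a : toℕ b ≤ toℕ a
    b≤a = ≮⇒≥ (λ a<b → subst T a<ᵇb (<⇒<ᵇ a<b))

  -- Each pair a < b is counted once for every third index: n ∸ suc b times
  -- as (u,v), b ∸ suc a times as (u,w) and a times as (v,w).
  sumTriples-perimeter : sumTriples n (λ u v w → d u v + d u w + d v w) ≡ (n ∸ 2) * sumPairs n d
  sumTriples-perimeter = begin
    sumTriples n (λ u v w → d u v + d u w + d v w)
      ≡⟨ sumFin³-cong (λ u v w → split (toℕ u <ᵇ toℕ v) (toℕ v <ᵇ toℕ w) (d u v) (d u w) (d v w)) ⟩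
    sumFin³ (λ u v w → ifIncreasing (λ u v w → d u v) u v w + ifIncreasing (λ u v w → d u w) u v w
                       + ifIncreasing (λ u v w → d v w) u v w)
      ≡⟨ trans (sumFin³-distrib-+ {n} _ _)
               (cong (_+ sumTriples n (λ u v w → d v w)) (sumFin³-distrib-+ {n} _ _)) ⟩
    sumTriples n (λ u v w → d u v) + sumTriples n (λ u v w → d u w) + sumTriples n (λ u v w → d v w)
      ≡⟨ cong₂ _+_ (cong₂ _+_ sumTriples-firstPair sumTriples-outerPair) sumTriples-lastPair ⟩
    sumFin² (λ a b → pair a b * (n ∸ suc (toℕ b))) + sumFin² (λ a b → d a b * (toℕ b ∸ suc (toℕ a)))
      + sumFin² (λ a b → toℕ a * pair a b)
      ≡⟨ sym (trans (sumFin²-distrib-+ {n} _ _)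
                    (cong (_+ sumFin² (λ a b → toℕ a * pair a b)) (sumFin²-distrib-+ {n} _ _))) ⟩
    sumFin² (λ a b → pair a b * (n ∸ suc (toℕ b)) + d a b * (toℕ b ∸ suc (toℕ a)) + toℕ a * pair a b)
      ≡⟨ sumFin²-cong pairWeights ⟩
    sumFin² (λ a b → (n ∸ 2) * pair a b)
      ≡⟨ sumFin²-distribˡ-* (n ∸ 2) pair ⟩
    (n ∸ 2) * sumPairs n d ∎
    where
    split : ∀ b c x y z → (if b then (if c then x + y + z else 0) else 0)
      ≡ (if b then (if c then x else 0) else 0) + (if b then (if c then y else 0) else 0)
        + (if b then (if c then z else 0) else 0)
    split true  true  x y z = refl
    split true  false x y z = refl
    split false c     x y z = refl

-- Walks

edgeAt? : ∀ {n} (u v x y : Fin n) → Dec ((u ≡ x × v ≡ y) ⊎ (u ≡ y × v ≡ x))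
edgeAt? u v x y = (u ≟ x ×-dec v ≟ y) ⊎-dec (u ≟ y ×-dec v ≟ x)

mapʷ : ∀ {n} {E E′ : Fin n → Fin n → Bool} → (∀ x y → E x y ≡ true → E′ x y ≡ true) →
  ∀ {a b} → Walk E a b → Walk E′ a b
mapʷ E⊆E′ []                = []
mapʷ E⊆E′ (_∷_ {u} {v} e p) = E⊆E′ u v e ∷ mapʷ E⊆E′ p

len-mapʷ : ∀ {n} {E E′ : Fin n → Fin n → Bool} (E⊆E′ : ∀ x y → E x y ≡ true → E′ x y ≡ true) →
  ∀ {a b} (p : Walk E a b) → len (mapʷ E⊆E′ p) ≡ len p
len-mapʷ E⊆E′ []      = refl
len-mapʷ E⊆E′ (e ∷ p) = cong suc (len-mapʷ E⊆E′ p)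

module _ {n : ℕ} {E : Fin n → Fin n → Bool} where

  open DecMembership (_≟_ {n}) using (_∈?_)

  infixr 5 _++ʷ_
  _++ʷ_ : ∀ {a b c} → Walk E a b → Walk E b c → Walk E a c
  []      ++ʷ q = q
  (e ∷ p) ++ʷ q = e ∷ (p ++ʷ q)

  len-++ʷ : ∀ {a b c} (p : Walk E a b) (q : Walk E b c) → len (p ++ʷ q) ≡ len p + len q
  len-++ʷ []      q = refl
  len-++ʷ (e ∷ p) q = cong suc (len-++ʷ p q)

  head∈verts : ∀ {a b} (p : Walk E a b) → a ∈ verts p
  head∈verts []      = here refl
  head∈verts (e ∷ p) = here refl

  last∈verts : ∀ {a b} (p : Walk E a b) → b ∈ verts p
  last∈verts []      = here refl
  last∈verts (e ∷ p) = there (last∈verts p)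

  splitAt : ∀ {a b z} (p : Walk E a b) → z ∈ verts p →
    Σ (Walk E a z) λ p₁ → Σ (Walk E z b) λ p₂ → len p₁ + len p₂ ≡ len p
  splitAt []      (here refl) = [] , [] , refl
  splitAt (e ∷ p) (here refl) = [] , e ∷ p , refl
  splitAt (e ∷ p) (there z∈p) with splitAt p z∈p
  ... | p₁ , p₂ , len-eq = e ∷ p₁ , p₂ , cong suc len-eq

  usesEdge? : ∀ {a b} (p : Walk E a b) x y → Dec (UsesEdge p x y)
  usesEdge? []                x y = no λ ()
  usesEdge? (_∷_ {u} {v} _ p) x y = edgeAt? u v x y ⊎-dec usesEdge? p x y

  edgesOf : ∀ {a b} → Walk E a b → Fin n → Fin n → Bool
  edgesOf p x y = does (usesEdge? p x y)

  usesEdge-sym : ∀ {a b x y} (p : Walk E a b) → UsesEdge p x y → UsesEdge p y x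
  usesEdge-sym (e ∷ p) (inj₁ (inj₁ u,v≡x,y)) = inj₁ (inj₂ u,v≡x,y)
  usesEdge-sym (e ∷ p) (inj₁ (inj₂ u,v≡y,x)) = inj₁ (inj₁ u,v≡y,x)
  usesEdge-sym (e ∷ p) (inj₂ uses)          = inj₂ (usesEdge-sym p uses)

  usesEdge⇒∈verts : ∀ {a b x y} (p : Walk E a b) → UsesEdge p x y → x ∈ verts p × y ∈ verts p
  usesEdge⇒∈verts (e ∷ p) (inj₁ (inj₁ (refl , refl))) = here refl , there (head∈verts p)
  usesEdge⇒∈verts (e ∷ p) (inj₁ (inj₂ (refl , refl))) = there (head∈verts p) , here refl
  usesEdge⇒∈verts (e ∷ p) (inj₂ uses) with usesEdge⇒∈verts p uses
  ... | x∈p , y∈p = there x∈p , there y∈p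

  usesEdge-++ʷˡ : ∀ {a b c x y} (p : Walk E a b) (q : Walk E b c) → UsesEdge p x y → UsesEdge (p ++ʷ q) x y
  usesEdge-++ʷˡ (e ∷ p) q (inj₁ step) = inj₁ step
  usesEdge-++ʷˡ (e ∷ p) q (inj₂ uses) = inj₂ (usesEdge-++ʷˡ p q uses)

  usesEdge-++ʷʳ : ∀ {a b c x y} (p : Walk E a b) (q : Walk E b c) → UsesEdge q x y → UsesEdge (p ++ʷ q) x y
  usesEdge-++ʷʳ []      q uses = uses
  usesEdge-++ʷʳ (e ∷ p) q uses = inj₂ (usesEdge-++ʷʳ p q uses)

  module _ (E-sym : ∀ x y → E x y ≡ E y x) where

    reverse : ∀ {a b} → Walk E a b → Walk E b a
    reverse []                = []
    reverse (_∷_ {u} {v} e p) = reverse p ++ʷ (trans (E-sym v u) e ∷ [])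

    len-reverse : ∀ {a b} (p : Walk E a b) → len (reverse p) ≡ len p
    len-reverse []      = refl
    len-reverse (e ∷ p) = trans (len-++ʷ (reverse p) _) (trans (cong (_+ 1) (len-reverse p)) (+-comm (len p) 1))

    usesEdge-reverse : ∀ {a b x y} (p : Walk E a b) → UsesEdge p x y → UsesEdge (reverse p) x y
    usesEdge-reverse (e ∷ p) (inj₁ (inj₁ u,v≡x,y)) = usesEdge-++ʷʳ (reverse p) _ (inj₁ (inj₂ (swap u,v≡x,y)))
    usesEdge-reverse (e ∷ p) (inj₁ (inj₂ u,v≡y,x)) = usesEdge-++ʷʳ (reverse p) _ (inj₁ (inj₁ (swap u,v≡y,x)))
    usesEdge-reverse (e ∷ p) (inj₂ uses)          = usesEdge-++ʷˡ (reverse p) _ (usesEdge-reverse p uses)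

    usesEdge⇒edge : ∀ {a b x y} (p : Walk E a b) → UsesEdge p x y → E x y ≡ true
    usesEdge⇒edge (e ∷ p) (inj₁ (inj₁ (refl , refl))) = e
    usesEdge⇒edge (e ∷ p) (inj₁ (inj₂ (refl , refl))) = trans (E-sym _ _) e
    usesEdge⇒edge (e ∷ p) (inj₂ uses)                  = usesEdge⇒edge p uses

  prefixOnEdges : ∀ {a b y} (p : Walk E a b) → y ∈ verts p → Walk (edgesOf p) a y
  prefixOnEdges []      (here refl) = []
  prefixOnEdges (e ∷ p) (here refl) = []
  prefixOnEdges (e ∷ p) (there y∈p) =
    dec-true (usesEdge? (e ∷ p) _ _) (inj₁ (inj₁ (refl , refl)))
    ∷ mapʷ (λ x y uses → dec-true (usesEdge? (e ∷ p) x y) (inj₂ (does⇒ (usesEdge? p x y) uses)))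
           (prefixOnEdges p y∈p)

  suffixFrom : ∀ {a b c} (p : Walk E c b) → a ∈ verts p → IsPath p → Σ (Walk E a b) IsPath
  suffixFrom []      (here refl) p-path       = [] , p-path
  suffixFrom (e ∷ p) (here refl) p-path       = e ∷ p , p-path
  suffixFrom (e ∷ p) (there a∈p) (_ ∷ p-path) = suffixFrom p a∈p p-path

  eraseLoops : ∀ {a b} → Walk E a b → Σ (Walk E a b) IsPath
  eraseLoops []          = [] , [] ∷ []
  eraseLoops {a} (e ∷ p) with eraseLoops p
  ... | p′ , p′-path with a ∈? verts p′
  ...   | yes a∈p′ = suffixFrom p′ a∈p′ p′-path
  ...   | no  a∉p′ = e ∷ p′ , ¬Any⇒All¬ (verts p′) a∉p′ ∷ p′-path

  AvoidsUntilLast : List (Fin n) → ∀ {a b} → Walk E a b → Set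
  AvoidsUntilLast P []            = ⊤
  AvoidsUntilLast P (_∷_ {u} _ q) = u ∉ P × AvoidsUntilLast P q

  avoidsUntilLast⇒usesEdge∉ : ∀ {P a b x y} (q : Walk E a b) → AvoidsUntilLast P q →
    UsesEdge q x y → x ∉ P ⊎ y ∉ P
  avoidsUntilLast⇒usesEdge∉ (e ∷ q) (u∉P , _) (inj₁ (inj₁ (refl , refl))) = inj₁ u∉P
  avoidsUntilLast⇒usesEdge∉ (e ∷ q) (u∉P , _) (inj₁ (inj₂ (refl , refl))) = inj₂ u∉P
  avoidsUntilLast⇒usesEdge∉ (e ∷ q) (_ , avoids) (inj₂ uses) = avoidsUntilLast⇒usesEdge∉ q avoids uses

  firstHit : (P : List (Fin n)) → ∀ {w u} (r : Walk E w u) → u ∈ P → IsPath r →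
    Σ (Fin n) λ x → x ∈ P × Σ (Walk E w x) λ q → IsPath q × AvoidsUntilLast P q × verts q ⊆ verts r
  firstHit P {w} []      u∈P r-path = w , u∈P , [] , r-path , tt , λ z∈q → z∈q
  firstHit P {w} (e ∷ r) u∈P (w∉r ∷ r-path) with w ∈? P
  ... | yes w∈P = w , w∈P , [] , [] ∷ [] , tt , λ { (here refl) → here refl }
  ... | no  w∉P with firstHit P r u∈P r-path
  ...   | x , x∈P , q , q-path , avoids , q⊆r =
          x , x∈P , e ∷ q , ¬Any⇒All¬ (verts q) (All¬⇒¬Any w∉r ∘ q⊆r) ∷ q-path , (w∉P , avoids) ,
          λ { (here refl) → here refl ; (there z∈q) → there (q⊆r z∈q) }

  firstEdge : ∀ {a b} → a ≢ b → (p : Walk E a b) → ∃ λ y → UsesEdge p a y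
  firstEdge a≢b []                = ⊥-elim (a≢b refl)
  firstEdge a≢b (_∷_ {v = y} e p) = y , inj₁ (inj₁ (refl , refl))

usesEdge-irrefl : ∀ {n} (G : Graph n) {a b x y} (p : Walk (adj G) a b) → UsesEdge p x y → x ≢ y
usesEdge-irrefl G p uses refl with trans (sym (usesEdge⇒edge (Graph.sym G) p uses)) (irrefl G _)
... | ()

-- Counting edges

module _ {n : ℕ} where

  countPairs : (Fin n → Fin n → Bool) → ℕ
  countPairs R = sumPairs n (λ x y → 𝟙 (R x y))

  countPairs-mono : {R R′ : Fin n → Fin n → Bool} → (∀ x y → R x y ≡ true → R′ x y ≡ true) →
    countPairs R ≤ countPairs R′
  countPairs-mono R⊆R′ = sumPairs-mono-≤ {n} λ x y → 𝟙-mono (R⊆R′ x y)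

  countPairs-∨-≤ : (R R′ : Fin n → Fin n → Bool) →
    countPairs (λ x y → R x y ∨ R′ x y) ≤ countPairs R + countPairs R′
  countPairs-∨-≤ R R′ = ≤-trans (sumPairs-mono-≤ {n} λ x y → 𝟙-∨-≤ (R x y) (R′ x y))
                                (≤-reflexive (sumPairs-distrib-+ {n} _ _))

  countPairs-⊎-disjoint : {A B : Fin n → Fin n → Set} (a? : ∀ x y → Dec (A x y)) (b? : ∀ x y → Dec (B x y)) →
    (∀ {x y} → A x y → ¬ B x y) →
    countPairs (λ x y → does (a? x y ⊎-dec b? x y))
      ≡ countPairs (λ x y → does (a? x y)) + countPairs (λ x y → does (b? x y))
  countPairs-⊎-disjoint a? b? disjoint = trans
    (sumPairs-cong {n} λ x y → 𝟙-∨-disjoint _ _ λ a → dec-false (b? x y) (disjoint (does⇒ (a? x y) a)))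
    (sumPairs-distrib-+ {n} _ _)

  countPairs-edgeAt-reversed : (u v : Fin n) →
    countPairs (λ x y → does (u ≟ y) ∧ does (v ≟ x)) ≡ 𝟙 (toℕ v <ᵇ toℕ u)
  countPairs-edgeAt-reversed u v =
    trans (sumPairs-cong {n} λ x y → cong 𝟙 (∧-comm (does (u ≟ y)) (does (v ≟ x)))) (sumPairs-δ v u)

  countPairs-edgeAt-≤1 : (u v : Fin n) → countPairs (λ x y → does (edgeAt? u v x y)) ≤ 1
  countPairs-edgeAt-≤1 u v = begin
    countPairs (λ x y → does (edgeAt? u v x y))
      ≤⟨ countPairs-∨-≤ _ _ ⟩
    countPairs (λ x y → does (u ≟ x) ∧ does (v ≟ y)) + countPairs (λ x y → does (u ≟ y) ∧ does (v ≟ x))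
      ≡⟨ cong₂ _+_ (sumPairs-δ u v) (countPairs-edgeAt-reversed u v) ⟩
    𝟙 (toℕ u <ᵇ toℕ v) + 𝟙 (toℕ v <ᵇ toℕ u)
      ≤⟨ 𝟙<ᵇ+𝟙>ᵇ≤1 (toℕ u) (toℕ v) ⟩
    1 ∎
    where open ≤-Reasoning

  countPairs-edgeAt≡1 : {u v : Fin n} → u ≢ v → countPairs (λ x y → does (edgeAt? u v x y)) ≡ 1
  countPairs-edgeAt≡1 {u} {v} u≢v = begin
    countPairs (λ x y → does (edgeAt? u v x y))
      ≡⟨ countPairs-⊎-disjoint (λ x y → u ≟ x ×-dec v ≟ y) (λ x y → u ≟ y ×-dec v ≟ x) opposite ⟩
    countPairs (λ x y → does (u ≟ x) ∧ does (v ≟ y)) + countPairs (λ x y → does (u ≟ y) ∧ does (v ≟ x))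
      ≡⟨ cong₂ _+_ (sumPairs-δ u v) (countPairs-edgeAt-reversed u v) ⟩
    𝟙 (toℕ u <ᵇ toℕ v) + 𝟙 (toℕ v <ᵇ toℕ u)
      ≡⟨ 𝟙<ᵇ+𝟙>ᵇ≡1 (u≢v ∘ Fin.toℕ-injective) ⟩
    1 ∎
    where
    open ≡-Reasoning
    opposite : ∀ {x y} → u ≡ x × v ≡ y → ¬ (u ≡ y × v ≡ x)
    opposite (refl , refl) (u≡v , _) = u≢v u≡v

  module _ {E : Fin n → Fin n → Bool} where

    countPairs-edgesOf-≤ : ∀ {a b} (p : Walk E a b) → countPairs (edgesOf p) ≤ len p
    countPairs-edgesOf-≤ []                = ≤-reflexive (sumPairs-zero {n})
    countPairs-edgesOf-≤ (_∷_ {u} {v} e p) =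
      ≤-trans (countPairs-∨-≤ _ _) (+-mono-≤ (countPairs-edgeAt-≤1 u v) (countPairs-edgesOf-≤ p))

    countPairs-edgesOf-path : ∀ {a b} (p : Walk E a b) → IsPath p → countPairs (edgesOf p) ≡ len p
    countPairs-edgesOf-path []                _               = sumPairs-zero {n}
    countPairs-edgesOf-path (_∷_ {u} {v} e p) (u∉p′ ∷ p-path) =
      trans (countPairs-⊎-disjoint (edgeAt? u v) (usesEdge? p) step∉p)
            (cong₂ _+_ (countPairs-edgeAt≡1 u≢v) (countPairs-edgesOf-path p p-path))
      where
      u∉p : u ∉ verts p
      u∉p = All¬⇒¬Any u∉p′
      u≢v : u ≢ v
      u≢v refl = u∉p (head∈verts p)
      step∉p : ∀ {x y} → (u ≡ x × v ≡ y) ⊎ (u ≡ y × v ≡ x) → ¬ UsesEdge p x y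
      step∉p (inj₁ (refl , _)) uses = u∉p (proj₁ (usesEdge⇒∈verts p uses))
      step∉p (inj₂ (refl , _)) uses = u∉p (proj₂ (usesEdge⇒∈verts p uses))

module _ {n : ℕ} (G : Graph n) {c : Fin n} (walks : List (Σ (Fin n) (Walk (adj G) c))) where

  open DecMembership (_≟_ {n}) using (_∈?_)

  onSome? : ∀ y → Dec (Any (λ w → y ∈ verts (proj₂ w)) walks)
  onSome? y = any? (λ w → y ∈? verts (proj₂ w)) walks

  usedBySome? : ∀ x y → Dec (Any (λ w → UsesEdge (proj₂ w) x y) walks)
  usedBySome? x y = any? (λ w → usesEdge? (proj₂ w) x y) walks

  star : Subgraph G
  star = record
    { vs      = λ y → does (onSome? y)
    ; es      = λ x y → does (usedBySome? x y)
    ; es-sym  = λ x y → does-⇔ (mk⇔ (Any.map λ {w} → usesEdge-sym (proj₂ w))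
                                    (Any.map λ {w} → usesEdge-sym (proj₂ w)))
                               (usedBySome? x y) (usedBySome? y x)
    ; es⊆E    = λ x y used → let (w , uses) = Any.satisfied (does⇒ (usedBySome? x y) used)
                              in usesEdge⇒edge (Graph.sym G) (proj₂ w) uses
    ; es-ends = λ x y used → dec-true (onSome? x)
                               (Any.map (λ {w} → proj₁ ∘ usesEdge⇒∈verts (proj₂ w)) (does⇒ (usedBySome? x y) used))
    }

  star-contains : ∀ {y p} → (y , p) ∈ walks → vs star y ≡ true
  star-contains {y} {p} p∈walks = dec-true (onSome? y) (lose p∈walks (last∈verts p))

  star-connected : SubConnected star
  star-connected y z y∈star z∈star = reverse (es-sym star) (fromCentre y∈star) ++ʷ fromCentre z∈star
    where
    fromCentre : ∀ {y} → vs star y ≡ true → Walk (es star) c y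
    fromCentre {y} y∈star with find (does⇒ (onSome? y) y∈star)
    ... | (_ , p) , p∈walks , y∈p =
      mapʷ (λ s t uses → dec-true (usedBySome? s t) (lose p∈walks (does⇒ (usesEdge? p s t) uses)))
           (prefixOnEdges p y∈p)

  star-edgeCount-≤ : edgeCount star ≤ sum (map (len ∘ proj₂) walks)
  star-edgeCount-≤ = countPairs-any-≤ walks
    where
    countPairs-any-≤ : (ws : List (Σ (Fin n) (Walk (adj G) c))) →
      countPairs (λ x y → does (any? (λ w → usesEdge? (proj₂ w) x y) ws)) ≤ sum (map (len ∘ proj₂) ws)
    countPairs-any-≤ []             = ≤-reflexive (sumPairs-zero {n})
    countPairs-any-≤ ((_ , p) ∷ ws) =
      ≤-trans (countPairs-∨-≤ {n} _ _) (+-mono-≤ (countPairs-edgesOf-≤ p) (countPairs-any-≤ ws))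

-- Distances, and the number of edges of connected subgraphs

module Distance {n : ℕ} (G : Graph n) (d : Fin n → Fin n → ℕ) (isD : IsDistance G d) where

  geodesic : ∀ u v → Walk (adj G) u v
  geodesic u v = proj₁ (proj₁ (isD u v))

  len-geodesic : ∀ u v → len (geodesic u v) ≡ d u v
  len-geodesic u v = proj₂ (proj₁ (isD u v))

  d≤len : ∀ {u v} (p : Walk (adj G) u v) → d u v ≤ len p
  d≤len {u} {v} = proj₂ (isD u v)

  d≤len-subgraph : (H : Subgraph G) → ∀ {u v} (p : Walk (es H) u v) → d u v ≤ len p
  d≤len-subgraph H p = subst (_ ≤_) (len-mapʷ (es⊆E H) p) (d≤len (mapʷ (es⊆E H) p))

  d-sym : ∀ u v → d u v ≡ d v u
  d-sym u v = ≤-antisym (d≤reversed u v) (d≤reversed v u)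
    where
    d≤reversed : ∀ u v → d u v ≤ d v u
    d≤reversed u v = subst (d u v ≤_) (trans (len-reverse (Graph.sym G) (geodesic v u)) (len-geodesic v u))
                                     (d≤len (reverse (Graph.sym G) (geodesic v u)))

  d-triangle : ∀ u v w → d u w ≤ d u v + d v w
  d-triangle u v w = subst (d u w ≤_)
    (trans (len-++ʷ (geodesic u v) (geodesic v w)) (cong₂ _+_ (len-geodesic u v) (len-geodesic v w)))
    (d≤len (geodesic u v ++ʷ geodesic v w))

  d-refl : ∀ u → d u u ≡ 0
  d-refl u = n≤0⇒n≡0 (d≤len {u} [])

  d≡0⇒≡ : ∀ {u v} → d u v ≡ 0 → u ≡ v
  d≡0⇒≡ {u} {v} d≡0 with geodesic u v | len-geodesic u v
  ... | []    | _        = refl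
  ... | _ ∷ _ | suc≡d = ⊥-elim (0≢1+n (trans (sym d≡0) (sym suc≡d)))

  on-geodesic : ∀ {a b z} (p : Walk (adj G) a b) → len p ≡ d a b → z ∈ verts p → d a z + d z b ≡ d a b
  on-geodesic {a} {b} {z} p len-p z∈p with splitAt p z∈p
  ... | p₁ , p₂ , len-split = ≤-antisym
    (subst (d a z + d z b ≤_) (trans len-split len-p) (+-mono-≤ (d≤len p₁) (d≤len p₂)))
    (d-triangle a z b)

  geodesic⇒path : ∀ {a b} (p : Walk (adj G) a b) → len p ≡ d a b → IsPath p
  geodesic⇒path []                      _     = [] ∷ []
  geodesic⇒path {a} {b} (_∷_ {v = c} e p) len-p = ¬Any⇒All¬ (verts p) a∉p ∷ geodesic⇒path p len-tail
    where
    len-tail : len p ≡ d c b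
    len-tail = ≤-antisym (+-cancelˡ-≤ 1 _ _ (subst (_≤ 1 + d c b) (sym len-p)
                 (≤-trans (d-triangle a c b) (+-monoˡ-≤ (d c b) (d≤len (e ∷ []))))))
               (d≤len p)
    a∉p : a ∉ verts p
    a∉p a∈p with splitAt p a∈p
    ... | p₁ , p₂ , len-split = <⇒≱ (s≤s (subst (len p₂ ≤_) len-split (m≤n+m (len p₂) (len p₁))))
                                     (subst (_≤ len p₂) (sym len-p) (d≤len p₂))

  sumDist-≤-edgeCount : (H : Subgraph G) → SubConnected H → ∀ {u v w} → Contains3 H u v w →
    ∃ λ x → d u x + d v x + d w x ≤ edgeCount H
  sumDist-≤-edgeCount H connected {u} {v} {w} (u∈H , v∈H , w∈H)
    with eraseLoops (connected u v u∈H v∈H) | eraseLoops (connected w u w∈H u∈H)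
  ... | p , p-path | r , r-path with firstHit (verts p) r (head∈verts p) r-path
  ... | x , x∈p , q , q-path , q-avoids , _ with splitAt p x∈p
  ... | p₁ , p₂ , len-split = x , (begin
    d u x + d v x + d w x
      ≡⟨ cong (λ t → d u x + t + d w x) (d-sym v x) ⟩
    d u x + d x v + d w x
      ≤⟨ +-mono-≤ (+-mono-≤ (d≤len-subgraph H p₁) (d≤len-subgraph H p₂)) (d≤len-subgraph H q) ⟩
    len p₁ + len p₂ + len q
      ≡⟨ cong (_+ len q) len-split ⟩
    len p + len q
      ≡⟨ sym (cong₂ _+_ (countPairs-edgesOf-path p p-path) (countPairs-edgesOf-path q q-path)) ⟩
    countPairs (edgesOf p) + countPairs (edgesOf q)
      ≡⟨ sym (countPairs-⊎-disjoint (usesEdge? p) (usesEdge? q) disjoint) ⟩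
    countPairs (λ s t → does (usesEdge? p s t ⊎-dec usesEdge? q s t))
      ≤⟨ countPairs-mono used⇒edge ⟩
    edgeCount H ∎)
    where
    open ≤-Reasoning
    disjoint : ∀ {s t} → UsesEdge p s t → ¬ UsesEdge q s t
    disjoint uses-p uses-q with usesEdge⇒∈verts p uses-p | avoidsUntilLast⇒usesEdge∉ q q-avoids uses-q
    ... | s∈p , _   | inj₁ s∉p = s∉p s∈p
    ... | _   , t∈p | inj₂ t∉p = t∉p t∈p
    used⇒edge : ∀ s t → does (usesEdge? p s t ⊎-dec usesEdge? q s t) ≡ true → es H s t ≡ true
    used⇒edge s t used with does⇒ (usesEdge? p s t ⊎-dec usesEdge? q s t) used
    ... | inj₁ uses-p = usesEdge⇒edge (es-sym H) p uses-p
    ... | inj₂ uses-q = usesEdge⇒edge (es-sym H) q uses-q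

  steiner-≤-sumDist : (d3 : Fin n → Fin n → Fin n → ℕ) → IsSteiner3 G d3 →
    ∀ x u v w → d3 u v w ≤ d u x + d v x + d w x
  steiner-≤-sumDist d3 isS x u v w = begin
    d3 u v w
      ≤⟨ proj₂ (isS u v w) (star G geodesics) (star-connected G geodesics)
                           ( star-contains G geodesics (here refl)
                           , star-contains G geodesics (there (here refl))
                           , star-contains G geodesics (there (there (here refl)))) ⟩
    edgeCount (star G geodesics)
      ≤⟨ star-edgeCount-≤ G geodesics ⟩
    len (geodesic x u) + (len (geodesic x v) + (len (geodesic x w) + 0))
      ≡⟨ cong₂ _+_ (len-geodesic x u) (cong₂ _+_ (len-geodesic x v) (trans (+-identityʳ _) (len-geodesic x w))) ⟩
    d x u + (d x v + d x w)
      ≡⟨ sym (+-assoc (d x u) _ _) ⟩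
    d x u + d x v + d x w
      ≡⟨ cong₂ _+_ (cong₂ _+_ (d-sym x u) (d-sym x v)) (d-sym x w) ⟩
    d u x + d v x + d w x ∎
    where
    open ≤-Reasoning
    geodesics : List (Σ (Fin n) (Walk (adj G) x))
    geodesics = (u , geodesic x u) ∷ (v , geodesic x v) ∷ (w , geodesic x w) ∷ []

-- Medians

squeeze : ∀ {a a′ b b′} → a ≤ a′ → b ≤ b′ → a′ + b′ ≤ a + b → a ≡ a′
squeeze {a} {a′} {b} {b′} a≤a′ b≤b′ sum≤ =
  ≤-antisym a≤a′ (+-cancelʳ-≤ b′ a′ a (≤-trans sum≤ (+-monoʳ-≤ a b≤b′)))

longest-side : ∀ a b c → a + b + c ≤ 2 * b → a + c ≤ b
longest-side a b c sum≤ =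
  +-cancelʳ-≤ b (a + c) b (subst₂ _≤_ (rearrange a b c) (cong (b +_) (+-identityʳ b)) sum≤)
  where
  rearrange : ∀ a b c → a + b + c ≡ a + c + b
  rearrange = solve-∀

module Medians {n : ℕ} (G : Graph n) (d : Fin n → Fin n → ℕ) (isD : IsDistance G d) where

  open Distance G d isD

  perimeter : Fin n → Fin n → Fin n → ℕ
  perimeter u v w = d u v + d u w + d v w

  sumDistTo : Fin n → Fin n → Fin n → Fin n → ℕ
  sumDistTo x u v w = d u x + d v x + d w x

  -- As perimeter u v w ≤ 2 * sumDistTo x u v w for every x, a witness x is
  -- exactly a vertex on geodesics between each two of u, v, w: a median.
  HasMedian : Fin n → Fin n → Fin n → Set
  HasMedian u v w = ∃ λ x → 2 * sumDistTo x u v w ≤ perimeter u v w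

  hasMedian? : ∀ u v w → Dec (HasMedian u v w)
  hasMedian? u v w = Fin.any? λ x → 2 * sumDistTo x u v w ≤? perimeter u v w

  2*sumDistTo≡ : ∀ x u v w → 2 * sumDistTo x u v w ≡ (d u x + d x v) + (d u x + d x w) + (d v x + d x w)
  2*sumDistTo≡ x u v w = begin
    2 * (d u x + d v x + d w x)
      ≡⟨ double (d u x) (d v x) (d w x) ⟩
    (d u x + d v x) + (d u x + d w x) + (d v x + d w x)
      ≡⟨ cong₂ (λ p q → (d u x + p) + (d u x + q) + (d v x + q)) (d-sym v x) (d-sym w x) ⟩
    (d u x + d x v) + (d u x + d x w) + (d v x + d x w) ∎
    where
    open ≡-Reasoning
    double : ∀ a b c → 2 * (a + b + c) ≡ (a + b) + (a + c) + (b + c)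
    double = solve-∀

  perimeter-≤-2*sumDistTo : ∀ x u v w → perimeter u v w ≤ 2 * sumDistTo x u v w
  perimeter-≤-2*sumDistTo x u v w = subst (perimeter u v w ≤_) (sym (2*sumDistTo≡ x u v w))
    (+-mono-≤ (+-mono-≤ (d-triangle u x v) (d-triangle u x w)) (d-triangle v x w))

  median⇒on-geodesics : ∀ {x u v w} → 2 * sumDistTo x u v w ≤ perimeter u v w →
    d u v ≡ d u x + d x v × d u w ≡ d u x + d x w × d v w ≡ d v x + d x w
  median⇒on-geodesics {x} {u} {v} {w} bound =
    squeeze (d-triangle u x v) (+-mono-≤ (d-triangle u x w) (d-triangle v x w))
            (subst₂ _≤_ (+-assoc (d u x + d x v) _ _) (+-assoc (d u v) _ _) bound′) ,
    squeeze (d-triangle u x w) (+-mono-≤ (d-triangle u x v) (d-triangle v x w))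
            (subst₂ _≤_ (middle-first (d u x + d x v) _ _) (middle-first (d u v) _ _) bound′) ,
    squeeze (d-triangle v x w) (+-mono-≤ (d-triangle u x v) (d-triangle u x w))
            (subst₂ _≤_ (+-comm (d u x + d x v + (d u x + d x w)) _) (+-comm (d u v + d u w) _) bound′)
    where
    bound′ : (d u x + d x v) + (d u x + d x w) + (d v x + d x w) ≤ perimeter u v w
    bound′ = subst (_≤ perimeter u v w) (2*sumDistTo≡ x u v w) bound
    middle-first : ∀ a b c → a + b + c ≡ b + (a + c)
    middle-first = solve-∀

  perimeter-swap₁₂ : ∀ u v w → perimeter v u w ≡ perimeter u v w
  perimeter-swap₁₂ u v w rewrite d-sym v u = reorder (d u v) (d v w) (d u w)
    where
    reorder : ∀ a b c → a + b + c ≡ a + c + b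
    reorder = solve-∀

  perimeter-swap₂₃ : ∀ u v w → perimeter u w v ≡ perimeter u v w
  perimeter-swap₂₃ u v w rewrite d-sym w v = reorder (d u w) (d u v) (d v w)
    where
    reorder : ∀ a b c → a + b + c ≡ b + a + c
    reorder = solve-∀

  hasMedian-swap₁₂ : ∀ {u v w} → HasMedian u v w → HasMedian v u w
  hasMedian-swap₁₂ {u} {v} {w} (x , bound) =
    x , subst₂ (λ s p → 2 * s ≤ p) (cong (_+ d w x) (+-comm (d u x) (d v x))) (sym (perimeter-swap₁₂ u v w)) bound

  hasMedian-swap₂₃ : ∀ {u v w} → HasMedian u v w → HasMedian u w v
  hasMedian-swap₂₃ {u} {v} {w} (x , bound) =
    x , subst₂ (λ s p → 2 * s ≤ p) (reorder (d u x) (d v x) (d w x)) (sym (perimeter-swap₂₃ u v w)) bound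
    where
    reorder : ∀ a b c → a + b + c ≡ a + c + b
    reorder = solve-∀

  hasMedian-rotate : ∀ {u v w} → HasMedian v w u → HasMedian u v w
  hasMedian-rotate = hasMedian-swap₁₂ ∘ hasMedian-swap₂₃

  perimeter-rotate : ∀ u v w → perimeter v w u ≡ perimeter u v w
  perimeter-rotate u v w = trans (perimeter-swap₂₃ v u w) (perimeter-swap₁₂ u v w)

  hasMedian-middle : ∀ {u v w} → d u v + d v w ≤ d u w → HasMedian u v w
  hasMedian-middle {u} {v} {w} short = v , (begin
    2 * (d u v + d v v + d w v)
      ≡⟨ cong₂ (λ p q → 2 * (d u v + p + q)) (d-refl v) (d-sym w v) ⟩
    2 * (d u v + 0 + d v w)
      ≡⟨ double (d u v) (d v w) ⟩
    (d u v + d v w) + (d u v + d v w)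
      ≤⟨ +-monoʳ-≤ (d u v + d v w) short ⟩
    (d u v + d v w) + d u w
      ≡⟨ reorder (d u v) (d v w) (d u w) ⟩
    perimeter u v w ∎)
    where
    open ≤-Reasoning
    double : ∀ a b → 2 * (a + 0 + b) ≡ (a + b) + (a + b)
    double = solve-∀
    reorder : ∀ a b c → (a + b) + c ≡ a + c + b
    reorder = solve-∀

  hasMedian-longest : ∀ {u v w} → perimeter u v w ≤ 2 * (d u v ⊔ d u w ⊔ d v w) → HasMedian u v w
  hasMedian-longest {u} {v} {w} short with ⊔-sel (d u v ⊔ d u w) (d v w) | ⊔-sel (d u v) (d u w)
  ... | inj₂ vw-longest | _ = hasMedian-swap₁₂ (hasMedian-middle (longest-side (d v u) (d v w) (d u w)
    (subst₂ (λ p m → p ≤ 2 * m) (sym (perimeter-swap₁₂ u v w)) vw-longest short)))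
  ... | inj₁ uv⊔uw | inj₁ uv-longest = hasMedian-swap₂₃ (hasMedian-middle (longest-side (d u w) (d u v) (d w v)
    (subst₂ (λ p m → p ≤ 2 * m) (sym (perimeter-swap₂₃ u v w)) (trans uv⊔uw uv-longest) short)))
  ... | inj₁ uv⊔uw | inj₂ uw-longest = hasMedian-middle (longest-side (d u v) (d u w) (d v w)
    (subst (λ m → perimeter u v w ≤ 2 * m) (trans uv⊔uw uw-longest) short))

  hasMedian-repeat₁₂ : ∀ u w → HasMedian u u w
  hasMedian-repeat₁₂ u w = hasMedian-middle (≤-reflexive (cong (_+ d u w) (d-refl u)))

  hasMedian-repeat₂₃ : ∀ u v → HasMedian u v v
  hasMedian-repeat₂₃ u v = hasMedian-middle (≤-reflexive (trans (cong (d u v +_) (d-refl v)) (+-identityʳ _)))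

  -- If z ≠ β lies on geodesics α–β and β–γ, moving β to z shortens the
  -- perimeter by 2 d β z, and a median of α z γ is one of α β γ.
  module _ {α β γ z : Fin n} (αzβ : d α z + d z β ≡ d α β) (βzγ : d β z + d z γ ≡ d β γ) where

    perimeter-shortcut : perimeter α β γ ≡ perimeter α z γ + 2 * d β z
    perimeter-shortcut = begin
      d α β + d α γ + d β γ
        ≡⟨ cong₂ (λ p q → p + d α γ + q) (sym αzβ) (sym βzγ) ⟩
      d α z + d z β + d α γ + (d β z + d z γ)
        ≡⟨ cong (λ t → d α z + t + d α γ + (d β z + d z γ)) (d-sym z β) ⟩
      d α z + d β z + d α γ + (d β z + d z γ)
        ≡⟨ reorder (d α z) (d β z) (d α γ) (d z γ) ⟩
      d α z + d α γ + d z γ + 2 * d β z ∎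
      where
      open ≡-Reasoning
      reorder : ∀ a b c e → a + b + c + (b + e) ≡ a + c + e + 2 * b
      reorder = solve-∀

    perimeter-shortcut-< : z ≢ β → perimeter α z γ < perimeter α β γ
    perimeter-shortcut-< z≢β = subst (perimeter α z γ <_) (sym perimeter-shortcut)
      (subst (_≤ perimeter α z γ + 2 * d β z) (+-comm (perimeter α z γ) 1)
        (+-monoʳ-≤ (perimeter α z γ) (≤-trans 1≤dβz (m≤n*m (d β z) 2))))
      where
      1≤dβz : 1 ≤ d β z
      1≤dβz with d β z in dβz
      ... | zero  = ⊥-elim (z≢β (sym (d≡0⇒≡ dβz)))
      ... | suc _ = s≤s z≤n

    hasMedian-shortcut : HasMedian α z γ → HasMedian α β γ
    hasMedian-shortcut (x , bound) = x , (begin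
      2 * (d α x + d β x + d γ x)
        ≤⟨ *-monoʳ-≤ 2 (+-monoˡ-≤ (d γ x) (+-monoʳ-≤ (d α x) (d-triangle β z x))) ⟩
      2 * (d α x + (d β z + d z x) + d γ x)
        ≡⟨ reorder (d α x) (d β z) (d z x) (d γ x) ⟩
      2 * (d α x + d z x + d γ x) + 2 * d β z
        ≤⟨ +-monoˡ-≤ (2 * d β z) bound ⟩
      perimeter α z γ + 2 * d β z
        ≡⟨ sym perimeter-shortcut ⟩
      perimeter α β γ ∎)
      where
      open ≤-Reasoning
      reorder : ∀ a b c e → 2 * (a + (b + c) + e) ≡ 2 * (a + c + e) + 2 * b
      reorder = solve-∀

  HasMediansBelow : Fin n → Fin n → Fin n → Set
  HasMediansBelow u v w = ∀ a b c → perimeter a b c < perimeter u v w → HasMedian a b c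

  hasMediansBelow-rotate : ∀ {u v w} → HasMediansBelow u v w → HasMediansBelow v w u
  hasMediansBelow-rotate {u} {v} {w} below a b c smaller =
    below a b c (subst (perimeter a b c <_) (perimeter-rotate u v w) smaller)

  hasMedian-commonVertex : ∀ {α β γ z} → HasMediansBelow α β γ →
    (P : Walk (adj G) α β) (Q : Walk (adj G) β γ) → len P ≡ d α β → len Q ≡ d β γ →
    z ∈ verts P → z ∈ verts Q → z ≢ β → HasMedian α β γ
  hasMedian-commonVertex {α} {β} {γ} {z} below P Q len-P len-Q z∈P z∈Q z≢β =
    hasMedian-shortcut αzβ βzγ (below α z γ (perimeter-shortcut-< αzβ βzγ z≢β))
    where
    αzβ = on-geodesic P len-P z∈P
    βzγ = on-geodesic Q len-Q z∈Q

  hasMedian-sharedEdge : ∀ {α β γ a b} → HasMediansBelow α β γ →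
    (P : Walk (adj G) α β) (Q : Walk (adj G) β γ) → len P ≡ d α β → len Q ≡ d β γ →
    UsesEdge P a b → UsesEdge Q a b → HasMedian α β γ
  hasMedian-sharedEdge {a = a} {b} below P Q len-P len-Q uses-P uses-Q with a ≟ _
  ... | no a≢β   = hasMedian-commonVertex below P Q len-P len-Q
                     (proj₁ (usesEdge⇒∈verts P uses-P)) (proj₁ (usesEdge⇒∈verts Q uses-Q)) a≢β
  ... | yes refl = hasMedian-commonVertex below P Q len-P len-Q
                     (proj₂ (usesEdge⇒∈verts P uses-P)) (proj₂ (usesEdge⇒∈verts Q uses-Q))
                     (usesEdge-irrefl G P uses-P ∘ sym)

  noMedian⇒badTriple : ∀ {u v w} → HasMediansBelow u v w → ¬ HasMedian u v w → BadTriple G d u v w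
  noMedian⇒badTriple {u} {v} {w} below noMedian =
    (λ { refl → noMedian (hasMedian-repeat₁₂ u w) }) ,
    (λ { refl → noMedian (hasMedian-repeat₂₃ u v) }) ,
    (λ { refl → noMedian (hasMedian-swap₂₃ (hasMedian-repeat₁₂ u v)) }) ,
    ≰⇒> (noMedian ∘ hasMedian-longest) ,
    λ (P , _ , len-P) (Q , _ , len-Q) (R , _ , len-R) →
      (λ x y uses-P uses-Q → noMedian (hasMedian-sharedEdge below P Q len-P len-Q uses-P uses-Q)) ,
      (λ x y uses-Q uses-R → noMedian (hasMedian-rotate
        (hasMedian-sharedEdge (hasMediansBelow-rotate below) Q R len-Q len-R uses-Q uses-R))) ,
      (λ x y uses-P uses-R → noMedian (hasMedian-rotate (hasMedian-rotate
        (hasMedian-sharedEdge (hasMediansBelow-rotate (hasMediansBelow-rotate below)) R P len-R len-P uses-R uses-P))))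

  hasMedian-all : ¬ (∃ λ u → ∃ λ v → ∃ λ w → BadTriple G d u v w) → ∀ u v w → HasMedian u v w
  hasMedian-all noBad u v w = <-rec AllMediansAt step (perimeter u v w) u v w refl
    where
    AllMediansAt : ℕ → Set
    AllMediansAt k = ∀ u v w → perimeter u v w ≡ k → HasMedian u v w
    step : ∀ k → (∀ {j} → j < k → AllMediansAt j) → AllMediansAt k
    step _ below u v w refl with hasMedian? u v w
    ... | yes hasMedian = hasMedian
    ... | no  noMedian  =
      ⊥-elim (noBad (u , v , w , noMedian⇒badTriple (λ a b c smaller → below smaller a b c refl) noMedian))

  badTriple⇒noMedian : ∀ {u v w} → BadTriple G d u v w → ¬ HasMedian u v w
  badTriple⇒noMedian {u} {v} {w} (_ , _ , _ , long , geodesics-disjoint) (x , bound) with x ≟ v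
  ... | yes refl = <⇒≱ long (begin
    d u v + d u w + d v w   ≡⟨ reorder (d u v) (d u w) (d v w) ⟩
    (d u v + d v w) + d u w ≡⟨ cong (_+ d u w) (sym uw-via-v) ⟩
    d u w + d u w           ≡⟨ sym (double (d u w)) ⟩
    2 * d u w               ≤⟨ *-monoʳ-≤ 2 (≤-trans (m≤n⊔m (d u v) (d u w)) (m≤m⊔n _ (d v w))) ⟩
    2 * (d u v ⊔ d u w ⊔ d v w) ∎)
    where
    open ≤-Reasoning
    uw-via-v : d u w ≡ d u v + d v w
    uw-via-v = proj₁ (proj₂ (median⇒on-geodesics bound))
    reorder : ∀ a b c → a + b + c ≡ (a + c) + b
    reorder = solve-∀
    double : ∀ a → 2 * a ≡ a + a
    double = solve-∀
  ... | no x≢v with firstEdge x≢v (geodesic x v)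
  ... | y , uses-g = proj₁ (geodesics-disjoint (P , geodesic⇒path P len-P , len-P)
                                               (Q , geodesic⇒path Q len-Q , len-Q)
                                               (R , geodesic⇒path R (len-geodesic w u) , len-geodesic w u))
      x y (usesEdge-++ʷʳ (geodesic u x) g uses-g)
          (usesEdge-++ʷˡ (reverse (Graph.sym G) g) (geodesic x w) (usesEdge-reverse (Graph.sym G) g uses-g))
    where
    g = geodesic x v
    P = geodesic u x ++ʷ g
    Q = reverse (Graph.sym G) g ++ʷ geodesic x w
    R = geodesic w u
    on-geodesics = median⇒on-geodesics bound
    len-P : len P ≡ d u v
    len-P = trans (len-++ʷ (geodesic u x) g)
                  (trans (cong₂ _+_ (len-geodesic u x) (len-geodesic x v)) (sym (proj₁ on-geodesics)))
    len-Q : len Q ≡ d v w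
    len-Q = trans (len-++ʷ (reverse (Graph.sym G) g) (geodesic x w))
                  (trans (cong₂ _+_ (trans (len-reverse (Graph.sym G) g) (trans (len-geodesic x v) (d-sym x v)))
                                    (len-geodesic x w))
                         (sym (proj₂ (proj₂ on-geodesics))))

ordered⇒distinct : ∀ {n} {P : Fin n → Fin n → Fin n → Set} →
  (∀ {a b c} → P a b c → P b a c) → (∀ {a b c} → P a b c → P a c b) →
  (∀ a b c → toℕ a < toℕ b → toℕ b < toℕ c → P a b c) →
  ∀ {u v w} → u ≢ v → v ≢ w → u ≢ w → P u v w
ordered⇒distinct swap₁₂ swap₂₃ ordered {u} {v} {w} u≢v v≢w u≢w
  with Fin.<-cmp u v | Fin.<-cmp v w | Fin.<-cmp u w
... | tri≈ _ u≡v _ | _            | _            = ⊥-elim (u≢v u≡v)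
... | _            | tri≈ _ v≡w _ | _            = ⊥-elim (v≢w v≡w)
... | _            | _            | tri≈ _ u≡w _ = ⊥-elim (u≢w u≡w)
... | tri< u<v _ _ | tri< v<w _ _ | _            = ordered u v w u<v v<w
... | tri< _ _ _   | tri> _ _ w<v | tri< u<w _ _ = swap₂₃ (ordered u w v u<w w<v)
... | tri< u<v _ _ | tri> _ _ _   | tri> _ _ w<u = swap₂₃ (swap₁₂ (ordered w u v w<u u<v))
... | tri> _ _ v<u | tri< _ _ _   | tri< u<w _ _ = swap₁₂ (ordered v u w v<u u<w)
... | tri> _ _ _   | tri< v<w _ _ | tri> _ _ w<u = swap₁₂ (swap₂₃ (ordered v w u v<w w<u))
... | tri> _ _ v<u | tri> _ _ w<v | _            = swap₁₂ (swap₂₃ (swap₁₂ (ordered w v u w<v v<u)))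

module Steiner {n : ℕ} (G : Graph n) (d : Fin n → Fin n → ℕ) (isD : IsDistance G d)
                (d3 : Fin n → Fin n → Fin n → ℕ) (isS : IsSteiner3 G d3) where

  open Distance G d isD
  open Medians G d isD

  sumDistTo-≤-d3 : ∀ u v w → ∃ λ x → sumDistTo x u v w ≤ d3 u v w
  sumDistTo-≤-d3 u v w with proj₁ (isS u v w)
  ... | H , connected , contains , edges≡d3 with sumDist-≤-edgeCount H connected contains
  ...   | x , bound = x , subst (_ ≤_) edges≡d3 bound

  perimeter-≤-2*d3 : ∀ u v w → perimeter u v w ≤ 2 * d3 u v w
  perimeter-≤-2*d3 u v w with sumDistTo-≤-d3 u v w
  ... | x , bound = ≤-trans (perimeter-≤-2*sumDistTo x u v w) (*-monoʳ-≤ 2 bound)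

  tight⇒hasMedian : ∀ {u v w} → 2 * d3 u v w ≡ perimeter u v w → HasMedian u v w
  tight⇒hasMedian {u} {v} {w} tight with sumDistTo-≤-d3 u v w
  ... | x , bound = x , ≤-trans (*-monoʳ-≤ 2 bound) (≤-reflexive tight)

  hasMedian⇒tight : ∀ {u v w} → HasMedian u v w → 2 * d3 u v w ≡ perimeter u v w
  hasMedian⇒tight {u} {v} {w} (x , bound) =
    ≤-antisym (≤-trans (*-monoʳ-≤ 2 (steiner-≤-sumDist d3 isS x u v w)) bound) (perimeter-≤-2*d3 u v w)

  W-≤-W3 : (n ∸ 2) * W d ≤ 2 * W3 d3
  W-≤-W3 = begin
    (n ∸ 2) * W d                          ≡⟨ sym (sumTriples-perimeter d) ⟩
    sumTriples n perimeter                 ≤⟨ sumTriples-mono-≤ perimeter-≤-2*d3 ⟩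
    sumTriples n (λ u v w → 2 * d3 u v w) ≡⟨ sumTriples-distribˡ-* 2 d3 ⟩
    2 * W3 d3                              ∎
    where open ≤-Reasoning

  W3-equality⇒noBadTriple : 2 * W3 d3 ≡ (n ∸ 2) * W d → ¬ (∃ λ u → ∃ λ v → ∃ λ w → BadTriple G d u v w)
  W3-equality⇒noBadTriple equality (u , v , w , bad@(u≢v , v≢w , u≢w , _)) =
    badTriple⇒noMedian bad (ordered⇒distinct hasMedian-swap₁₂ hasMedian-swap₂₃ orderedMedian u≢v v≢w u≢w)
    where
    sums≡ : sumTriples n perimeter ≡ sumTriples n (λ u v w → 2 * d3 u v w)
    sums≡ = trans (sumTriples-perimeter d) (trans (sym equality) (sym (sumTriples-distribˡ-* 2 d3)))
    orderedMedian : ∀ a b c → toℕ a < toℕ b → toℕ b < toℕ c → HasMedian a b c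
    orderedMedian a b c a<b b<c =
      tight⇒hasMedian (sym (sumTriples-≤-equality perimeter-≤-2*d3 sums≡ a b c a<b b<c))

  noBadTriple⇒W3-equality : ¬ (∃ λ u → ∃ λ v → ∃ λ w → BadTriple G d u v w) → 2 * W3 d3 ≡ (n ∸ 2) * W d
  noBadTriple⇒W3-equality noBad = begin
    2 * W3 d3                              ≡⟨ sym (sumTriples-distribˡ-* 2 d3) ⟩
    sumTriples n (λ u v w → 2 * d3 u v w) ≡⟨ sumTriples-cong tight ⟩
    sumTriples n perimeter                 ≡⟨ sumTriples-perimeter d ⟩
    (n ∸ 2) * W d                          ∎
    where
    open ≡-Reasoning
    tight : ∀ u v w → 2 * d3 u v w ≡ perimeter u v w
    tight u v w = hasMedian⇒tight (hasMedian-all noBad u v w)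

mainTheorem3 : (n : ℕ) → 3 ≤ n → (G : Graph n) → Connected G →
    (d : Fin n → Fin n → ℕ) → IsDistance G d →
    (d3 : Fin n → Fin n → Fin n → ℕ) → IsSteiner3 G d3 →
    ((n ∸ 2) * W d ≤ 2 * W3 d3)
    × (2 * W3 d3 ≡ (n ∸ 2) * W d ⇔ (¬ (∃ λ u → ∃ λ v → ∃ λ w → BadTriple G d u v w)))
mainTheorem3 n _ G _ d isD d3 isS = W-≤-W3 , mk⇔ W3-equality⇒noBadTriple noBadTriple⇒W3-equality
  where open Steiner G d isD d3 isS
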